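{- Let $R$ be a commutative ring with unity, let $f,d\in R[x]$ and let $g(x)=\sum_{k\geq0}a_kx^k\in R[[x]]$ satisfy $d(x)g(x)=f(x)$. Suppose $d(x)$ divides $x^n-1$ in $R[x]$ and that the leading coefficient of $d(x)$ is not a zero-divisor. Then $a_k=a_{k+n}$ for all $k\geq 0$ with $k>\deg(f)-\deg(d)$. -}

module Defs where

open import Algebra.Bundles using (CommutativeRing)
open import Data.Nat using (ℕ; zero; suc; _∸_; _≤_; _<_; _≡ᵇ_)
open import Data.Bool using (if_then_else_)
open import Data.Product using (∃; _×_)
import Level

module _ {c ℓ} (R : CommutativeRing c ℓ) where
  open CommutativeRing R

  -- Formal power series over R: coefficient sequences. Polynomials are
  -- those with finite support.
  Series : Set c
  Series = ℕ → Carrier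

  sumTo : (ℕ → Carrier) → ℕ → Carrier
  sumTo h zero    = h 0
  sumTo h (suc k) = sumTo h k + h (suc k)

  _⊛_ : Series → Series → Series
  (p ⊛ q) k = sumTo (λ i → p i * q (k ∸ i)) k

  IsPoly : Series → Set ℓ
  IsPoly p = ∃ λ b → ∀ i → b ≤ i → p i ≈ 0#

  -- all coefficients of index ≥ b vanish (i.e. deg p < b, with deg 0 = -∞)
  VanishFrom : Series → ℕ → Set ℓ
  VanishFrom p b = ∀ i → b ≤ i → p i ≈ 0#

  VanishAbove : Series → ℕ → Set ℓ
  VanishAbove p m = ∀ i → m < i → p i ≈ 0#

  NonZeroDivisor : Carrier → Set (c Level.⊔ ℓ)
  NonZeroDivisor a = ∀ r → a * r ≈ 0# → r ≈ 0#

  xⁿ-1 : ℕ → Series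
  xⁿ-1 n i = (if i ≡ᵇ n then 1# else 0#) - (if i ≡ᵇ 0 then 1# else 0#)

  PolyDivides : Series → Series → Set (c Level.⊔ ℓ)
  PolyDivides p q = ∃ λ r → IsPoly r × (∀ k → (p ⊛ r) k ≈ q k)

-- Write d r = xⁿ − 1 with r a polynomial.  Because the leading coefficient of d is not a
-- zero divisor, deg (d r) = deg d + deg r, so deg r ≤ n − deg d.  Hence
-- (xⁿ − 1) g = r (d g) = r f, whose coefficient of x^(k+n) is zero as soon as
-- k + n > (n − deg d) + deg f; on the left that coefficient is g k − g (k + n).
module Submission where

open import Defs
open import Algebra.Bundles using (CommutativeRing)
open import Data.Bool using (if_then_else_)
open import Data.Nat as Nat using (ℕ; zero; suc; _∸_; _≤_; _<_; _≡ᵇ_; z≤n; _≟_; _≤?_)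
import Data.Nat.Properties as ℕₚ
open import Data.Product using (_,_)
open import Function using (_∘_)
open import Data.Sum using (_⊎_; inj₁; inj₂)
open import Relation.Binary.PropositionalEquality using (_≡_; _≢_; ≢-sym; cong; subst)
import Relation.Binary.PropositionalEquality as ≡
open import Relation.Nullary using (yes; no)
open import Relation.Nullary.Decidable using (dec-true; dec-false)

module SeriesProperties {c ℓ} (R : CommutativeRing c ℓ) where
  open CommutativeRing R hiding (zero)
  open import Relation.Binary.Reasoning.Setoid setoid
  open import Algebra.Properties.Ring ring using ([y-z]x≈yx-zx)
  open import Algebra.Properties.AbelianGroup +-abelianGroup using (⁻¹-∙-comm)
  open import Algebra.Properties.CommutativeSemigroup +-commutativeSemigroup using (interchange)

  ∑ : (ℕ → Carrier) → ℕ → Carrier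
  ∑ = sumTo R

  infixl 7 _∗_
  _∗_ : Series R → Series R → Series R
  _∗_ = _⊛_ R

  x^_ : ℕ → Series R
  (x^ a) i = if i ≡ᵇ a then 1# else 0#

  sumTo-cong : ∀ {h h′ : ℕ → Carrier} K → (∀ i → i ≤ K → h i ≈ h′ i) → ∑ h K ≈ ∑ h′ K
  sumTo-cong zero    h≈h′ = h≈h′ 0 z≤n
  sumTo-cong (suc K) h≈h′ =
    +-cong (sumTo-cong K λ i i≤K → h≈h′ i (ℕₚ.m≤n⇒m≤1+n i≤K)) (h≈h′ (suc K) ℕₚ.≤-refl)

  sumTo-zero : ∀ {h : ℕ → Carrier} K → (∀ i → i ≤ K → h i ≈ 0#) → ∑ h K ≈ 0#
  sumTo-zero zero    h≈0 = h≈0 0 z≤n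
  sumTo-zero (suc K) h≈0 = begin
    ∑ _ K + _ ≈⟨ +-cong (sumTo-zero K λ i i≤K → h≈0 i (ℕₚ.m≤n⇒m≤1+n i≤K)) (h≈0 (suc K) ℕₚ.≤-refl) ⟩
    0# + 0#   ≈⟨ +-identityˡ 0# ⟩
    0#        ∎

  sumTo-single : ∀ {h : ℕ → Carrier} K a → a ≤ K → (∀ i → i ≤ K → i ≢ a → h i ≈ 0#) →
                 ∑ h K ≈ h a
  sumTo-single zero    zero z≤n _   = refl
  sumTo-single {h} (suc K) a a≤1+K others with a ≟ suc K
  ... | yes ≡.refl = begin
    ∑ h K + h a ≈⟨ +-cong (sumTo-zero K λ i i≤K → others i (ℕₚ.m≤n⇒m≤1+n i≤K) (ℕₚ.<⇒≢ (Nat.s≤s i≤K)))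
                          refl ⟩
    0# + h a    ≈⟨ +-identityˡ (h a) ⟩
    h a         ∎
  ... | no a≢1+K = begin
    ∑ h K + h (suc K) ≈⟨ +-cong (sumTo-single K a a≤K λ i i≤K → others i (ℕₚ.m≤n⇒m≤1+n i≤K))
                                (others (suc K) ℕₚ.≤-refl (≢-sym a≢1+K)) ⟩
    h a + 0#          ≈⟨ +-identityʳ (h a) ⟩
    h a               ∎
    where
    a≤K : a ≤ K
    a≤K = ℕₚ.≤-pred (ℕₚ.≤∧≢⇒< a≤1+K a≢1+K)

  sumTo-+ : ∀ (h h′ : ℕ → Carrier) K → ∑ (λ i → h i + h′ i) K ≈ ∑ h K + ∑ h′ K
  sumTo-+ h h′ zero    = refl
  sumTo-+ h h′ (suc K) =
    trans (+-cong (sumTo-+ h h′ K) refl) (interchange (∑ h K) (∑ h′ K) (h (suc K)) (h′ (suc K)))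

  sumTo-neg : ∀ (h : ℕ → Carrier) K → ∑ (λ i → - h i) K ≈ - ∑ h K
  sumTo-neg h zero    = refl
  sumTo-neg h (suc K) = trans (+-cong (sumTo-neg h K) refl) (⁻¹-∙-comm (∑ h K) (h (suc K)))

  *-distribˡ-sumTo : ∀ a (h : ℕ → Carrier) K → a * ∑ h K ≈ ∑ (λ i → a * h i) K
  *-distribˡ-sumTo a h zero    = refl
  *-distribˡ-sumTo a h (suc K) =
    trans (distribˡ a (∑ h K) (h (suc K))) (+-cong (*-distribˡ-sumTo a h K) refl)

  *-distribʳ-sumTo : ∀ a (h : ℕ → Carrier) K → ∑ h K * a ≈ ∑ (λ i → h i * a) K
  *-distribʳ-sumTo a h zero    = refl
  *-distribʳ-sumTo a h (suc K) =
    trans (distribʳ a (∑ h K) (h (suc K))) (+-cong (*-distribʳ-sumTo a h K) refl)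

  sumTo-unconsˡ : ∀ (h : ℕ → Carrier) K → ∑ h (suc K) ≈ h 0 + ∑ (λ i → h (suc i)) K
  sumTo-unconsˡ h zero    = refl
  sumTo-unconsˡ h (suc K) = trans (+-cong (sumTo-unconsˡ h K) refl) (+-assoc _ _ _)

  sumTo-reverse : ∀ (h : ℕ → Carrier) K → ∑ h K ≈ ∑ (λ i → h (K ∸ i)) K
  sumTo-reverse h zero    = refl
  sumTo-reverse h (suc K) = begin
    ∑ h K + h (suc K)                  ≈⟨ +-cong (sumTo-reverse h K) refl ⟩
    ∑ (λ i → h (K ∸ i)) K + h (suc K)  ≈⟨ +-comm _ _ ⟩
    h (suc K) + ∑ (λ i → h (K ∸ i)) K  ≈⟨ sumTo-unconsˡ (λ i → h (suc K ∸ i)) K ⟨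
    ∑ (λ i → h (suc K ∸ i)) (suc K)    ∎

  -- Exchanging the order of summation over j ≤ i ≤ K; on the right t = i − j.
  sumTo-swap-triangle : ∀ (F : ℕ → ℕ → Carrier) K →
    ∑ (λ i → ∑ (F i) i) K ≈ ∑ (λ j → ∑ (λ t → F (j Nat.+ t) j) (K ∸ j)) K
  sumTo-swap-triangle F zero    = refl
  sumTo-swap-triangle F (suc K) = begin
    ∑ (λ i → ∑ (F i) i) K + (∑ (F (suc K)) K + F (suc K) (suc K))
      ≈⟨ +-cong (sumTo-swap-triangle F K) refl ⟩
    ∑ (λ j → ∑ (inner j) (K ∸ j)) K + (∑ (F (suc K)) K + F (suc K) (suc K))
      ≈⟨ +-assoc _ _ _ ⟨
    (∑ (λ j → ∑ (inner j) (K ∸ j)) K + ∑ (F (suc K)) K) + F (suc K) (suc K)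
      ≈⟨ +-cong (sumTo-+ _ _ K) (reflexive (cong (λ i → F i (suc K)) (ℕₚ.+-identityʳ (suc K)))) ⟨
    ∑ (λ j → ∑ (inner j) (K ∸ j) + F (suc K) j) K + inner (suc K) 0
      ≈⟨ +-cong (sumTo-cong K extend-row) (reflexive (cong (∑ (inner (suc K))) (≡.sym (ℕₚ.n∸n≡0 K)))) ⟩
    ∑ (λ j → ∑ (inner j) (suc K ∸ j)) (suc K)
      ∎
    where
    inner : ℕ → ℕ → Carrier
    inner j t = F (j Nat.+ t) j
    extend-row : ∀ j → j ≤ K → ∑ (inner j) (K ∸ j) + F (suc K) j ≈ ∑ (inner j) (suc K ∸ j)
    extend-row j j≤K rewrite ℕₚ.+-∸-assoc 1 j≤K =
      +-cong refl (reflexive (cong (λ i → F i j) 1+K≡j+[1+K∸j]))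
      where
      1+K≡j+[1+K∸j] : suc K ≡ j Nat.+ suc (K ∸ j)
      1+K≡j+[1+K∸j] = ≡.sym (≡.trans (ℕₚ.+-suc j (K ∸ j)) (cong suc (ℕₚ.m+[n∸m]≡n j≤K)))

  ∗-congˡ : ∀ p {q q′ : Series R} → (∀ i → q i ≈ q′ i) → ∀ k → (p ∗ q) k ≈ (p ∗ q′) k
  ∗-congˡ p q≈q′ k = sumTo-cong k λ i _ → *-cong refl (q≈q′ (k ∸ i))

  ∗-congʳ : ∀ {p p′ : Series R} q → (∀ i → p i ≈ p′ i) → ∀ k → (p ∗ q) k ≈ (p′ ∗ q) k
  ∗-congʳ q p≈p′ k = sumTo-cong k λ i _ → *-cong (p≈p′ i) refl

  ∗-comm : ∀ p q k → (p ∗ q) k ≈ (q ∗ p) k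
  ∗-comm p q k = trans (sumTo-reverse _ k) (sumTo-cong k λ i i≤k →
    trans (*-comm _ _) (*-cong (reflexive (cong q (ℕₚ.m∸[m∸n]≡n i≤k))) refl))

  ∗-assoc : ∀ p q s k → ((p ∗ q) ∗ s) k ≈ (p ∗ (q ∗ s)) k
  ∗-assoc p q s k = begin
    ∑ (λ i → ∑ (λ j → p j * q (i ∸ j)) i * s (k ∸ i)) k
      ≈⟨ sumTo-cong k (λ i _ → *-distribʳ-sumTo _ _ i) ⟩
    ∑ (λ i → ∑ (λ j → p j * q (i ∸ j) * s (k ∸ i)) i) k
      ≈⟨ sumTo-swap-triangle (λ i j → p j * q (i ∸ j) * s (k ∸ i)) k ⟩
    ∑ (λ j → ∑ (λ t → p j * q (j Nat.+ t ∸ j) * s (k ∸ (j Nat.+ t))) (k ∸ j)) k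
      ≈⟨ sumTo-cong k (λ j _ → sumTo-cong (k ∸ j) (λ t _ → reindex j t)) ⟩
    ∑ (λ j → ∑ (λ t → p j * (q t * s (k ∸ j ∸ t))) (k ∸ j)) k
      ≈⟨ sumTo-cong k (λ j _ → *-distribˡ-sumTo (p j) _ (k ∸ j)) ⟨
    ∑ (λ j → p j * ∑ (λ t → q t * s (k ∸ j ∸ t)) (k ∸ j)) k
      ∎
    where
    reindex : ∀ j t → p j * q (j Nat.+ t ∸ j) * s (k ∸ (j Nat.+ t)) ≈ p j * (q t * s (k ∸ j ∸ t))
    reindex j t = trans (*-assoc _ _ _)
      (*-cong refl (*-cong (reflexive (cong q (ℕₚ.m+n∸m≡n j t)))
                           (reflexive (cong s (≡.sym (ℕₚ.∸-+-assoc k j t))))))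

  ∗-distribʳ-- : ∀ p q s k → ((λ i → p i - q i) ∗ s) k ≈ (p ∗ s) k - (q ∗ s) k
  ∗-distribʳ-- p q s k = begin
    ∑ (λ i → (p i - q i) * s (k ∸ i)) k
      ≈⟨ sumTo-cong k (λ i _ → [y-z]x≈yx-zx (s (k ∸ i)) (p i) (q i)) ⟩
    ∑ (λ i → p i * s (k ∸ i) - q i * s (k ∸ i)) k
      ≈⟨ sumTo-+ _ _ k ⟩
    (p ∗ s) k + ∑ (λ i → - (q i * s (k ∸ i))) k
      ≈⟨ +-cong refl (sumTo-neg _ k) ⟩
    (p ∗ s) k - (q ∗ s) k
      ∎

  ∗≈0 : ∀ (p q : Series R) K → (∀ i → i ≤ K → p i ≈ 0# ⊎ q (K ∸ i) ≈ 0#) → (p ∗ q) K ≈ 0#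
  ∗≈0 p q K p≈0⊎q≈0 = sumTo-zero K λ i i≤K → term i (p≈0⊎q≈0 i i≤K)
    where
    term : ∀ i → p i ≈ 0# ⊎ q (K ∸ i) ≈ 0# → p i * q (K ∸ i) ≈ 0#
    term i (inj₁ pᵢ≈0) = trans (*-cong pᵢ≈0 refl) (zeroˡ _)
    term i (inj₂ q≈0)  = trans (*-cong refl q≈0) (zeroʳ _)

  ∗-top-coefficient : ∀ {p q : Series R} {m n} → VanishAbove R p m → VanishAbove R q n →
                      (p ∗ q) (m Nat.+ n) ≈ p m * q n
  ∗-top-coefficient {p} {q} {m} {n} p≤m q≤n = begin
    (p ∗ q) (m Nat.+ n)      ≈⟨ sumTo-single (m Nat.+ n) m (ℕₚ.m≤m+n m n) off-diagonal ⟩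
    p m * q (m Nat.+ n ∸ m)  ≈⟨ *-cong refl (reflexive (cong q (ℕₚ.m+n∸m≡n m n))) ⟩
    p m * q n                ∎
    where
    off-diagonal : ∀ i → i ≤ m Nat.+ n → i ≢ m → p i * q (m Nat.+ n ∸ i) ≈ 0#
    off-diagonal i _ i≢m with m Nat.<? i
    ... | yes m<i = trans (*-cong (p≤m i m<i) refl) (zeroˡ _)
    ... | no  m≮i = trans (*-cong refl (q≤n (m Nat.+ n ∸ i) n<m+n∸i)) (zeroʳ _)
      where
      i<m : i < m
      i<m = ℕₚ.≤∧≢⇒< (ℕₚ.≮⇒≥ m≮i) i≢m
      n<m+n∸i : n < m Nat.+ n ∸ i
      n<m+n∸i = subst (n <_) (≡.sym (ℕₚ.+-∸-comm n (ℕₚ.<⇒≤ i<m)))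
                      (ℕₚ.+-monoˡ-≤ n (ℕₚ.m<n⇒0<n∸m i<m))

  vanishFrom-pred : ∀ {p : Series R} {b} → VanishFrom R p (suc b) → p b ≈ 0# → VanishFrom R p b
  vanishFrom-pred {b = b} p>b p_b≈0 i b≤i with b ≟ i
  ... | yes ≡.refl = p_b≈0
  ... | no  b≢i    = p>b i (ℕₚ.≤∧≢⇒< b≤i b≢i)

  -- Downward induction from a bound on the support of r; each step reads off the top
  -- coefficient of d r and cancels the non-zero-divisor d m.
  vanishFrom-∗-cancelˡ : ∀ {d r : Series R} {m j} → VanishAbove R d m → NonZeroDivisor R (d m) →
    IsPoly R r → VanishFrom R (d ∗ r) (m Nat.+ j) → VanishFrom R r j
  vanishFrom-∗-cancelˡ {d} {r} {m} {j} d≤m dₘ-regular (B , r<B) dr<m+j = descend B r<B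
    where
    descend : ∀ b → VanishFrom R r b → VanishFrom R r j
    descend zero    r<0   i _ = r<0 i z≤n
    descend (suc b) r<1+b with suc b ≤? j
    ... | yes b<j = λ i j≤i → r<1+b i (ℕₚ.≤-trans b<j j≤i)
    ... | no  b≮j = descend b (vanishFrom-pred r<1+b (dₘ-regular (r b) dₘr_b≈0))
      where
      dₘr_b≈0 : d m * r b ≈ 0#
      dₘr_b≈0 = begin
        d m * r b            ≈⟨ ∗-top-coefficient d≤m r<1+b ⟨
        (d ∗ r) (m Nat.+ b)  ≈⟨ dr<m+j (m Nat.+ b) (ℕₚ.+-monoʳ-≤ m (ℕₚ.≮⇒≥ b≮j)) ⟩
        0#                   ∎

  x^-∗ : ∀ a s K → a ≤ K → (x^ a ∗ s) K ≈ s (K ∸ a)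
  x^-∗ a s K a≤K = trans (sumTo-single K a a≤K off) on
    where
    off : ∀ i → i ≤ K → i ≢ a → (x^ a) i * s (K ∸ i) ≈ 0#
    off i _ i≢a rewrite dec-false (i ≟ a) i≢a = zeroˡ _
    on : (x^ a) a * s (K ∸ a) ≈ s (K ∸ a)
    on rewrite dec-true (a ≟ a) ≡.refl = *-identityˡ _

  xⁿ-1-vanishAbove : ∀ n → VanishAbove R (xⁿ-1 R n) n
  xⁿ-1-vanishAbove n i n<i
    rewrite dec-false (i ≟ n) (ℕₚ.>⇒≢ n<i) | dec-false (i ≟ 0) (ℕₚ.>⇒≢ (ℕₚ.≤-<-trans z≤n n<i))
    = -‿inverseʳ 0#

  xⁿ-1-∗ : ∀ n g k → (xⁿ-1 R n ∗ g) (k Nat.+ n) ≈ g k - g (k Nat.+ n)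
  xⁿ-1-∗ n g k = begin
    (xⁿ-1 R n ∗ g) (k Nat.+ n)
      ≈⟨ ∗-distribʳ-- (x^ n) (x^ 0) g (k Nat.+ n) ⟩
    (x^ n ∗ g) (k Nat.+ n) - (x^ 0 ∗ g) (k Nat.+ n)
      ≈⟨ +-cong (x^-∗ n g (k Nat.+ n) (ℕₚ.m≤n+m n k)) (-‿cong (x^-∗ 0 g (k Nat.+ n) z≤n)) ⟩
    g (k Nat.+ n ∸ n) - g (k Nat.+ n)
      ≈⟨ +-cong (reflexive (cong g (ℕₚ.m+n∸n≡m k n))) refl ⟩
    g k - g (k Nat.+ n)
      ∎

open Nat using (_+_)

lemma3p8 : ∀ {c ℓ} (R : CommutativeRing c ℓ) → let open CommutativeRing R using (_≈_) in
    (f d g : Series R) (m b n : ℕ) →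
    IsPoly R f → VanishFrom R f b →
    VanishAbove R d m → NonZeroDivisor R (d m) →
    (∀ k → _⊛_ R d g k ≈ f k) →
    PolyDivides R d (xⁿ-1 R n) →
    ∀ k → b ≤ k + m → g k ≈ g (k + n)
lemma3p8 R f d g m b n _ f<b d≤m dₘ-regular dg≈f (r , r-poly , dr≈xⁿ-1) k b≤k+m =
  x∙y⁻¹≈ε⇒x≈y (g k) (g (k + n)) (begin
    g k - g (k + n)             ≈⟨ xⁿ-1-∗ n g k ⟨
    (xⁿ-1 R n ∗ g) (k + n)      ≈⟨ ∗-congʳ g (sym ∘ dr≈xⁿ-1) (k + n) ⟩
    ((d ∗ r) ∗ g) (k + n)       ≈⟨ ∗-congʳ g (∗-comm d r) (k + n) ⟩
    ((r ∗ d) ∗ g) (k + n)       ≈⟨ ∗-assoc r d g (k + n) ⟩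
    (r ∗ (d ∗ g)) (k + n)       ≈⟨ ∗-congˡ r dg≈f (k + n) ⟩
    (r ∗ f) (k + n)             ≈⟨ ∗≈0 r f (k + n) r-or-f-vanishes ⟩
    0#                          ∎)
  where
  open CommutativeRing R using (_≈_; _-_; 0#; refl; sym; trans; setoid; +-abelianGroup)
  open SeriesProperties R
  open import Relation.Binary.Reasoning.Setoid setoid
  open import Algebra.Properties.AbelianGroup +-abelianGroup using (x∙y⁻¹≈ε⇒x≈y)

  r>n∸m : VanishFrom R r (suc n ∸ m)
  r>n∸m = vanishFrom-∗-cancelˡ d≤m dₘ-regular r-poly λ i le →
    trans (dr≈xⁿ-1 i) (xⁿ-1-vanishAbove n i (ℕₚ.≤-trans (ℕₚ.m≤n+m∸n (suc n) m) le))

  r-or-f-vanishes : ∀ i → i ≤ k + n → r i ≈ 0# ⊎ f (k + n ∸ i) ≈ 0#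
  r-or-f-vanishes i _ with m + i ≤? n
  ... | no  m+i≰n = inj₁ (r>n∸m i (ℕₚ.m≤n+o⇒m∸n≤o (suc n) m (ℕₚ.≰⇒> m+i≰n)))
  ... | yes m+i≤n = inj₂ (f<b (k + n ∸ i) (ℕₚ.≤-trans b≤k+m k+m≤k+n∸i))
    where
    k+m≤k+n∸i : k + m ≤ k + n ∸ i
    k+m≤k+n∸i = subst (k + m ≤_) (≡.sym (ℕₚ.+-∸-assoc k (ℕₚ.m+n≤o⇒n≤o m m+i≤n)))
                      (ℕₚ.+-monoʳ-≤ k (ℕₚ.m+n≤o⇒m≤o∸n m m+i≤n))
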